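{- Let $S_1,S_2\in[0\mathinner{.\,.}\sigma)^+$ with $\sigma\ge3$, $n_1=|S_1|$, $n_2=|S_2|$, and $k=\lceil\log\sigma\rceil$. For $a\in[0\mathinner{.\,.}\sigma)$ let $C(a)=\mathrm{pad}_k(\mathrm{bin}_k(a))$, and let $B=1^{2k-1}0$. Define $S'_1=B\cdot C(S_1[1])\cdot B\cdot C(S_1[2])\cdot B\cdots B\cdot C(S_1[n_1])\cdot B$ and $S'_2=B\cdot C(S_2[1])\cdot B\cdot C(S_2[2])\cdot B\cdots B\cdot C(S_2[n_2])\cdot B$. Then $\mathrm{LCF}(S_1,S_2)=\left\lfloor\dfrac{\mathrm{LCF}(S'_1,S'_2)-2k}{4k}\right\rfloor$.
   Context: For $x\in[0\mathinner{.\,.}2^k)$, $\mathrm{bin}_k(x)\in\{0,1\}^k$ is the binary representation of $x$ with leading zeros. For $X\in\{0,1\}^k$, $\mathrm{pad}_k(X)\in\{0,1\}^{2k}$ is the string $Y$ with $Y[2i-1]=X[i]$ and $Y[2i]=0$ for $i\in[1\mathinner{.\,.}k]$. $\mathrm{LCF}(X,Y)$ is the length of a longest string occurring as a substring of both $X$ and $Y$. -}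

module Defs where

open import Data.Nat using (ℕ; zero; suc; _+_; _*_; _∸_; _^_; _≤_; _⊔_; NonZero; >-nonZero; z≤n; s≤s)
open import Data.Nat.DivMod using (_/_; _%_)
open import Data.Nat.Logarithm using (⌈log₂_⌉; ⌈log₂⌉-mono-≤; ⌈log₂2^n⌉≡n)
open import Data.Nat.Properties using (≤-trans; ≤-reflexive)
open import Data.Bool using (Bool; true; false)
open import Data.Fin using (Fin; toℕ)
open import Data.List using (List; []; _∷_; [_]; _++_; length; map; concat; concatMap; foldr; replicate; take; drop; upTo)
open import Data.Bool.ListAction using (any)
open import Data.List.Properties using (≡-dec)
open import Relation.Binary.Definitions using (DecidableEquality)
open import Relation.Nullary.Decidable using (does)
open import Relation.Binary.PropositionalEquality using (_≡_; sym)

-- Binary strings: alphabet Bool, with true = 1 and false = 0.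

-- bin k x : the k-bit binary representation of x (most significant bit first,
-- leading zeros).  Meaningful for x < 2^k.
bin : ℕ → ℕ → List Bool
bin zero    x = []
bin (suc k) x = bin k (x / 2) ++ [ does (x % 2 Data.Nat.≟ 1) ]
  where import Data.Nat

pad : List Bool → List Bool
pad = concatMap (λ b → b ∷ false ∷ [])

substrings : {A : Set} → List A → List (List A)
substrings X =
  concatMap (λ j → map (λ i → drop i (take j X)) (upTo (suc j))) (upTo (suc (length X)))

LCF : {A : Set} → DecidableEquality A → List A → List A → ℕ
LCF _≟_ X Y =
  foldr _⊔_ 0
    (map (λ U → if any (λ V → does (≡-dec _≟_ U V)) (substrings Y) then length U else 0)
         (substrings X))
  where open import Data.Bool using (if_then_else_)

C : ℕ → {σ : ℕ} → Fin σ → List Bool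
C k a = pad (bin k (toℕ a))

Bk : ℕ → List Bool
Bk k = replicate (2 * k ∸ 1) true ++ [ false ]

encode : ℕ → {σ : ℕ} → List (Fin σ) → List Bool
encode k S = Bk k ++ concatMap (λ a → C k a ++ Bk k) S

nz4k : (σ : ℕ) → 3 ≤ σ → NonZero (4 * ⌈log₂ σ ⌉)
nz4k σ h = >-nonZero (≤-trans (s≤s z≤n) (Data.Nat.Properties.*-monoʳ-≤ 4 k≥1))
  where
  import Data.Nat.Properties
  k≥1 : 1 ≤ ⌈log₂ σ ⌉
  k≥1 = ≤-trans (≤-reflexive (sym (⌈log₂2^n⌉≡n 1))) (⌈log₂⌉-mono-≤ {2} {σ} (≤-trans (s≤s (s≤s z≤n)) h))

{-# OPTIONS --safe #-}
-- The encoding is a sequence of blocks B·C(a) of length 4k followed by a last B, so a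
-- common factor of length l of S₁ and S₂ encodes to a common factor of length 4kl + 2k.
-- Conversely, a run of 2k-1 ones starts only at a block boundary: inside a code word
-- every 1 is followed by a 0, and B ends in 0.  A common factor of the encodings of
-- length at least 4k(l+1) + 2k contains a complete separator of the first encoding, so
-- both of its occurrences are aligned with the block structure and cover l + 1
-- consecutive code words, which agree.  As C is injective, they spell a common factor
-- of length l + 1 of S₁ and S₂.
module Submission where

open import Defs
open import Data.Nat
  using (ℕ; zero; suc; _+_; _*_; _∸_; _^_; _⊔_; _≤_; _<_; z≤n; s≤s; s≤s⁻¹; z<s;
         NonZero; >-nonZero; ⌈_/2⌉; _<?_; _≤?_)
open import Data.Nat.Properties
open import Data.Nat.DivMod
  using (_/_; _%_; m≡m%n+[m/n]*n; m%n<n; m%n≤n; m*n/n≡m; /-monoˡ-≤; m<n*o⇒m/o<n)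
open import Data.Nat.Divisibility using (_∣_; divides; m%n≡0⇒n∣m)
open import Data.Nat.Logarithm using (⌈log₂_⌉; ⌈log₂⌉-mono-≤)
open import Data.Nat.Logarithm.Core using (⌈log2⌉)
open import Data.Bool using (Bool; true; false; T; if_then_else_)
open import Data.Bool.ListAction using (any)
import Data.Bool.Properties
open import Data.Maybe using (Maybe; just; nothing)
open import Data.Maybe.Properties using (just-injective)
open import Data.Fin using (Fin; toℕ)
import Data.Fin.Properties
open import Data.Fin.Properties using (toℕ-injective; toℕ<n)
open import Data.List
  using (List; []; _∷_; [_]; _++_; length; map; concatMap; foldr; take; drop; replicate; upTo)
open import Data.List.Properties
  using (length-++; length-replicate; length-take; ++-assoc; ++-identityʳ; concatMap-++;
         take++drop≡id; ≡-dec; ∷-injectiveˡ; ∷-injectiveʳ; ∷ʳ-injective)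
open import Data.List.Membership.Propositional using (_∈_)
open import Data.List.Membership.Propositional.Properties
  using (∈-concat⁺′; ∈-concat⁻′; ∈-map⁺; ∈-map⁻; ∈-upTo⁺; foldr-selective)
open import Data.List.Relation.Unary.Any using (here; there)
open import Data.Product using (∃; ∃₂; _×_; _,_; proj₁; proj₂)
open import Data.Sum using (inj₁; inj₂)
open import Data.Empty using (⊥)
open import Induction.WellFounded using (Acc; acc)
open import Relation.Binary.Definitions using (DecidableEquality)
open import Relation.Nullary using (yes; no; does; ¬_; contradiction)
open import Relation.Binary.PropositionalEquality
  using (_≡_; refl; sym; trans; cong; cong₂; subst; subst₂; module ≡-Reasoning)

module _ {A : Set} where

  _!?_ : List A → ℕ → Maybe A
  []       !? _     = nothing
  (x ∷ xs) !? zero  = just x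
  (x ∷ xs) !? suc n = xs !? n

  !?-++ˡ : ∀ xs {ys n} → n < length xs → (xs ++ ys) !? n ≡ xs !? n
  !?-++ˡ (x ∷ xs) {n = zero}  _        = refl
  !?-++ˡ (x ∷ xs) {n = suc n} (s≤s n<) = !?-++ˡ xs n<

  !?-++ʳ : ∀ xs {ys} n → (xs ++ ys) !? (length xs + n) ≡ ys !? n
  !?-++ʳ []       n = refl
  !?-++ʳ (x ∷ xs) n = !?-++ʳ xs n

  !?-drop : ∀ i xs n → drop i xs !? n ≡ xs !? (i + n)
  !?-drop zero    xs       n = refl
  !?-drop (suc i) []       n = refl
  !?-drop (suc i) (x ∷ xs) n = !?-drop i xs n

  !?-take : ∀ {j} xs {n} → n < j → take j xs !? n ≡ xs !? n
  !?-take {suc j} []       _                 = refl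
  !?-take {suc j} (x ∷ xs) {zero}  _         = refl
  !?-take {suc j} (x ∷ xs) {suc n} (s≤s n<j) = !?-take xs n<j

  !?-window : ∀ X i {n t} → t < n → take n (drop i X) !? t ≡ X !? (i + t)
  !?-window X i t<n = trans (!?-take (drop i X) t<n) (!?-drop i X _)

  !?-replicate : ∀ {m n} {x : A} → n < m → replicate m x !? n ≡ just x
  !?-replicate {suc m} {zero}  _         = refl
  !?-replicate {suc m} {suc n} (s≤s n<m) = !?-replicate n<m

  !?-≥length : ∀ xs {n} → length xs ≤ n → xs !? n ≡ nothing
  !?-≥length []       _           = refl
  !?-≥length (x ∷ xs) (s≤s len≤n) = !?-≥length xs len≤n

  !?-just⇒<length : ∀ xs {n x} → xs !? n ≡ just x → n < length xs
  !?-just⇒<length (y ∷ xs) {zero}  _ = z<s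
  !?-just⇒<length (y ∷ xs) {suc n} e = s≤s (!?-just⇒<length xs e)

  <length⇒!?-just : ∀ xs {n} → n < length xs → ∃ λ x → xs !? n ≡ just x
  <length⇒!?-just (x ∷ xs) {zero}  _        = x , refl
  <length⇒!?-just (x ∷ xs) {suc n} (s≤s n<) = <length⇒!?-just xs n<

  !?-ext-≤ : ∀ {xs ys n} → length xs ≤ n → length ys ≤ n →
             (∀ t → t < n → xs !? t ≡ ys !? t) → xs ≡ ys
  !?-ext-≤ {[]}     {[]}     _         _         _  = refl
  !?-ext-≤ {[]}     {y ∷ ys} _         (s≤s _)   eq with () ← eq 0 z<s
  !?-ext-≤ {x ∷ xs} {[]}     (s≤s _)   _         eq with () ← eq 0 z<s
  !?-ext-≤ {x ∷ xs} {y ∷ ys} (s≤s xs≤) (s≤s ys≤) eq =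
    cong₂ _∷_ (just-injective (eq 0 z<s)) (!?-ext-≤ xs≤ ys≤ λ t t<n → eq (suc t) (s≤s t<n))

module _ {A : Set} where

  private
    slices : List A → ℕ → List (List A)
    slices X j = map (λ i → drop i (take j X)) (upTo (suc j))

  drop-take∈substrings : ∀ (X : List A) {i j} → i ≤ j → j ≤ length X → drop i (take j X) ∈ substrings X
  drop-take∈substrings X {i} {j} i≤j j≤|X| =
    ∈-concat⁺′ (∈-map⁺ (λ i → drop i (take j X)) (∈-upTo⁺ (s≤s i≤j)))
               (∈-map⁺ (slices X) (∈-upTo⁺ (s≤s j≤|X|)))

  ∈substrings⇒drop-take : ∀ (X : List A) {U} → U ∈ substrings X → ∃₂ λ i j → U ≡ drop i (take j X)
  ∈substrings⇒drop-take X U∈ with ∈-concat⁻′ (map (slices X) (upTo (suc (length X)))) U∈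
  ... | Us , U∈Us , Us∈ with ∈-map⁻ (slices X) Us∈
  ...   | j , _ , refl with ∈-map⁻ (λ i → drop i (take j X)) {xs = upTo (suc j)} U∈Us
  ...     | i , _ , refl = i , j , refl

  drop-take-infix : ∀ (P U Q : List A) → drop (length P) (take (length P + length U) (P ++ U ++ Q)) ≡ U
  drop-take-infix []      []      Q = refl
  drop-take-infix []      (u ∷ U) Q = cong (u ∷_) (drop-take-infix [] U Q)
  drop-take-infix (p ∷ P) U       Q = drop-take-infix P U Q

  infix∈substrings : ∀ (P U Q : List A) → U ∈ substrings (P ++ U ++ Q)
  infix∈substrings P U Q = subst (_∈ substrings (P ++ U ++ Q)) (drop-take-infix P U Q)
    (drop-take∈substrings (P ++ U ++ Q) (m≤m+n (length P) (length U)) fits)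
    where
    fits : length P + length U ≤ length (P ++ U ++ Q)
    fits = begin
      length P + length U              ≤⟨ +-monoʳ-≤ (length P) (m≤m+n (length U) (length Q)) ⟩
      length P + (length U + length Q) ≡⟨ cong (length P +_) (length-++ U) ⟨
      length P + length (U ++ Q)       ≡⟨ length-++ P ⟨
      length (P ++ U ++ Q)             ∎
      where open ≤-Reasoning

  ∈substrings⇒infix : ∀ (X : List A) {U} → U ∈ substrings X → ∃₂ λ P Q → X ≡ P ++ U ++ Q
  ∈substrings⇒infix X U∈ with ∈substrings⇒drop-take X U∈
  ... | i , j , refl = take i (take j X) , drop j X , (begin
      X                                                    ≡⟨ take++drop≡id j X ⟨
      take j X ++ drop j X                                 ≡⟨ cong (_++ drop j X) (take++drop≡id i (take j X)) ⟨
      (take i (take j X) ++ drop i (take j X)) ++ drop j X ≡⟨ ++-assoc (take i (take j X)) _ _ ⟩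
      take i (take j X) ++ drop i (take j X) ++ drop j X   ∎)
    where open ≡-Reasoning

  window∈substrings : ∀ (X : List A) i n → take n (drop i X) ∈ substrings X
  window∈substrings X i n = subst (λ Z → take n (drop i X) ∈ substrings Z) split
    (infix∈substrings (take i X) (take n (drop i X)) (drop n (drop i X)))
    where
    split : take i X ++ take n (drop i X) ++ drop n (drop i X) ≡ X
    split = trans (cong (take i X ++_) (take++drop≡id n (drop i X))) (take++drop≡id i X)

∈⇒≤foldr-⊔ : ∀ {x xs} → x ∈ xs → x ≤ foldr _⊔_ 0 xs
∈⇒≤foldr-⊔ (here refl) = m≤m⊔n _ _
∈⇒≤foldr-⊔ (there x∈)  = m≤n⇒m≤o⊔n _ (∈⇒≤foldr-⊔ x∈)

module _ {A : Set} (_≟_ : DecidableEquality A) where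

  private
    equals : List A → List A → Bool
    equals U V = does (≡-dec _≟_ U V)

    score : List A → List A → ℕ
    score Y U = if any (equals U) (substrings Y) then length U else 0

    ∈⇒any : ∀ {U Vs} → U ∈ Vs → T (any (equals U) Vs)
    ∈⇒any {U} {V ∷ Vs} U∈ with ≡-dec _≟_ U V | U∈
    ... | yes _  | _          = _
    ... | no U≢V | here U≡V   = contradiction U≡V U≢V
    ... | no _   | there U∈Vs = ∈⇒any U∈Vs

    any⇒∈ : ∀ {U Vs} → T (any (equals U) Vs) → U ∈ Vs
    any⇒∈ {U} {V ∷ Vs} found with ≡-dec _≟_ U V
    ... | yes U≡V = here U≡V
    ... | no _    = there (any⇒∈ found)

    score-common : ∀ {U Y} → U ∈ substrings Y → score Y U ≡ length U
    score-common {U} {Y} U∈ with any (equals U) (substrings Y) | ∈⇒any U∈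
    ... | true | _ = refl

  LCF-≥ : ∀ X Y {U} → U ∈ substrings X → U ∈ substrings Y → length U ≤ LCF _≟_ X Y
  LCF-≥ X Y {U} U∈X U∈Y =
    subst (_≤ LCF _≟_ X Y) (score-common {U} {Y} U∈Y) (∈⇒≤foldr-⊔ (∈-map⁺ (score Y) U∈X))

  LCF-attained : ∀ X Y → ∃ λ U → U ∈ substrings X × U ∈ substrings Y × length U ≡ LCF _≟_ X Y
  LCF-attained X Y with foldr-selective ⊔-sel 0 (map (score Y) (substrings X))
  ... | inj₁ LCF≡0 = [] , window∈substrings X 0 0 , window∈substrings Y 0 0 , sym LCF≡0
  ... | inj₂ LCF∈  with ∈-map⁻ (score Y) LCF∈
  ...   | U , U∈X , LCF≡score with any (equals U) (substrings Y) | any⇒∈ {U} {substrings Y}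
  ...     | true  | U∈Y = U , U∈X , U∈Y _ , sym LCF≡score
  ...     | false | _   = [] , window∈substrings X 0 0 , window∈substrings Y 0 0 , sym LCF≡score

module _ {A : Set} where

  record Match (X : List A) (i : ℕ) (Y : List A) (j n : ℕ) : Set where
    constructor matching
    field agree : ∀ t → t < n → ∃ λ x → X !? (i + t) ≡ just x × Y !? (j + t) ≡ just x

  open Match public

  match-≤ : ∀ {X Y i j m n} → m ≤ n → Match X i Y j n → Match X i Y j m
  match-≤ m≤n m = matching λ t t<m → agree m t (<-≤-trans t<m m≤n)

  match-drop : ∀ {X Y i j n} t → Match X i Y j (t + n) → Match X (i + t) Y (j + t) n
  match-drop {X} {Y} {i} {j} t m = matching λ u u<n →
    subst₂ (λ p q → ∃ λ x → X !? p ≡ just x × Y !? q ≡ just x) (sym (+-assoc i t u)) (sym (+-assoc j t u))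
      (agree m (t + u) (+-monoʳ-< t u<n))

  ∈substrings⇒occurrence : ∀ (X : List A) {U} → U ∈ substrings X →
                           ∃ λ i → ∀ t → t < length U → X !? (i + t) ≡ U !? t
  ∈substrings⇒occurrence X {U} U∈ with ∈substrings⇒infix X U∈
  ... | P , Q , refl = length P , λ t t<|U| → trans (!?-++ʳ P t) (!?-++ˡ U t<|U|)

  common⇒match : ∀ (X Y : List A) {U} → U ∈ substrings X → U ∈ substrings Y →
                 ∃₂ λ i j → Match X i Y j (length U)
  common⇒match X Y {U} U∈X U∈Y with ∈substrings⇒occurrence X U∈X | ∈substrings⇒occurrence Y U∈Y
  ... | i , X≈U | j , Y≈U = i , j , matching λ t t<|U| →
    let x , U!?t = <length⇒!?-just U t<|U|
    in x , trans (X≈U t t<|U|) U!?t , trans (Y≈U t t<|U|) U!?t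

  match⇒window≡ : ∀ {X Y i j n} → Match X i Y j n → take n (drop i X) ≡ take n (drop j Y)
  match⇒window≡ {X} {Y} {i} {j} {n} m =
    !?-ext-≤ (length-window X i) (length-window Y j) λ t t<n →
      let x , X!? , Y!? = agree m t t<n in
      trans (!?-window X i t<n) (trans X!? (sym (trans (!?-window Y j t<n) Y!?)))
    where
    length-window : ∀ Z k → length (take n (drop k Z)) ≤ n
    length-window Z k = ≤-trans (≤-reflexive (length-take n (drop k Z))) (m⊓n≤m n _)

  match⇒≤length : ∀ {X Y i j} n → Match X i Y j n → n ≤ length (take n (drop i X))
  match⇒≤length             zero    _ = z≤n
  match⇒≤length {X} {i = i} (suc n) m =
    let x , X!? , _ = agree m n ≤-refl in
    !?-just⇒<length (take (suc n) (drop i X)) (trans (!?-window X i ≤-refl) X!?)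

  match⇒≤LCF : ∀ (_≟_ : DecidableEquality A) {X Y i j n} → Match X i Y j n → n ≤ LCF _≟_ X Y
  match⇒≤LCF _≟_ {X} {Y} {i} {j} {n} m = ≤-trans (match⇒≤length n m)
    (LCF-≥ _≟_ X Y (window∈substrings X i n)
                   (subst (_∈ substrings Y) (sym (match⇒window≡ m)) (window∈substrings Y j n)))

++-concatMap-rotate : ∀ {A B : Set} (ys : List B) (f : A → List B) xs →
                      ys ++ concatMap (λ x → f x ++ ys) xs ≡ concatMap (λ x → ys ++ f x) xs ++ ys
++-concatMap-rotate         ys f []       = ++-identityʳ ys
++-concatMap-rotate {A} {B} ys f (x ∷ xs) = begin
  ys ++ (f x ++ ys) ++ concatMap g xs   ≡⟨ cong (ys ++_) (++-assoc (f x) ys _) ⟩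
  ys ++ f x ++ ys ++ concatMap g xs     ≡⟨ cong (λ zs → ys ++ f x ++ zs) (++-concatMap-rotate ys f xs) ⟩
  ys ++ f x ++ concatMap h xs ++ ys     ≡⟨ ++-assoc ys (f x) _ ⟨
  (ys ++ f x) ++ concatMap h xs ++ ys   ≡⟨ ++-assoc (ys ++ f x) (concatMap h xs) ys ⟨
  ((ys ++ f x) ++ concatMap h xs) ++ ys ∎
  where
  open ≡-Reasoning
  g h : A → List B
  g x = f x ++ ys
  h x = ys ++ f x

m∣n+[m∸n%m] : ∀ m n .{{_ : NonZero m}} → m ∣ n + (m ∸ n % m)
m∣n+[m∸n%m] m n = divides (suc (n / m)) (begin
  n + (m ∸ n % m)                   ≡⟨ cong (_+ (m ∸ n % m)) (m≡m%n+[m/n]*n n m) ⟩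
  n % m + n / m * m + (m ∸ n % m)   ≡⟨ cong (_+ (m ∸ n % m)) (+-comm (n % m) (n / m * m)) ⟩
  n / m * m + n % m + (m ∸ n % m)   ≡⟨ +-assoc (n / m * m) (n % m) (m ∸ n % m) ⟩
  n / m * m + (n % m + (m ∸ n % m)) ≡⟨ cong (n / m * m +_) (m+[n∸m]≡n (m%n≤n n m)) ⟩
  n / m * m + m                     ≡⟨ +-comm (n / m * m) m ⟩
  suc (n / m) * m                   ∎)
  where open ≡-Reasoning

m*n≤o<[1+m]*n⇒o/n≡m : ∀ {m n o} .{{_ : NonZero n}} → m * n ≤ o → o < suc m * n → o / n ≡ m
m*n≤o<[1+m]*n⇒o/n≡m {m} {n} {o} lower upper =
  ≤-antisym (s≤s⁻¹ (m<n*o⇒m/o<n upper)) (subst (_≤ o / n) (m*n/n≡m m n) (/-monoˡ-≤ n lower))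

encodeWith : {A : Set} → ℕ → (A → List Bool) → List A → List Bool
encodeWith k code S = Bk k ++ concatMap (λ a → code a ++ Bk k) S

module BlockEncoding {A : Set} (k : ℕ) (2≤k : 2 ≤ k) (code : A → List Bool)
                     (length-code : ∀ a → length (code a) ≡ 2 * k) where

  K M : ℕ
  K = 2 * k
  M = 4 * k

  B : List Bool
  B = Bk k

  enc : List A → List Bool
  enc = encodeWith k code

  M≡K+K : M ≡ K + K
  M≡K+K = *-distribʳ-+ k 2 2

  4≤K : 4 ≤ K
  4≤K = *-monoʳ-≤ 2 2≤k

  K≤M : K ≤ M
  K≤M = subst (K ≤_) (sym M≡K+K) (m≤m+n K K)

  3≤K∸1 : 3 ≤ K ∸ 1
  3≤K∸1 = ∸-monoˡ-≤ 1 4≤K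

  K∸1<K : K ∸ 1 < K
  K∸1<K = ∸-monoʳ-< z<s (≤-trans (s≤s z≤n) 4≤K)

  instance
    M-nonZero : NonZero M
    M-nonZero = >-nonZero (≤-trans (s≤s z≤n) (≤-trans 4≤K K≤M))

  length-B : length B ≡ K
  length-B = begin
    length (replicate (K ∸ 1) true ++ [ false ]) ≡⟨ length-++ (replicate (K ∸ 1) true) ⟩
    length (replicate (K ∸ 1) true) + 1          ≡⟨ cong (_+ 1) (length-replicate (K ∸ 1)) ⟩
    K ∸ 1 + 1                                    ≡⟨ m∸n+n≡m (≤-trans (s≤s z≤n) 4≤K) ⟩
    K                                            ∎
    where open ≡-Reasoning

  B-ones : ∀ {u} → u < K ∸ 1 → B !? u ≡ just true
  B-ones u<K∸1 =
    trans (!?-++ˡ (replicate (K ∸ 1) true) (subst (_ <_) (sym (length-replicate (K ∸ 1))) u<K∸1))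
          (!?-replicate u<K∸1)

  B-last : B !? (K ∸ 1) ≡ just false
  B-last = subst (λ n → B !? n ≡ just false) (trans (+-identityʳ _) (length-replicate (K ∸ 1)))
                 (!?-++ʳ (replicate (K ∸ 1) true) 0)

  enc-∷ : ∀ a S → enc (a ∷ S) ≡ B ++ code a ++ enc S
  enc-∷ a S = cong (B ++_) (++-assoc (code a) B (concatMap (λ a → code a ++ B) S))

  length-enc : ∀ S → length (enc S) ≡ length S * M + K
  length-enc []      = trans (cong length (++-identityʳ B)) length-B
  length-enc (a ∷ S) = begin
    length (enc (a ∷ S))                          ≡⟨ cong length (enc-∷ a S) ⟩
    length (B ++ code a ++ enc S)                 ≡⟨ length-++ B ⟩
    length B + length (code a ++ enc S)           ≡⟨ cong (length B +_) (length-++ (code a)) ⟩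
    length B + (length (code a) + length (enc S)) ≡⟨ cong₂ (λ b c → b + (c + length (enc S)))
                                                           length-B (length-code a) ⟩
    K + (K + length (enc S))                      ≡⟨ +-assoc K K _ ⟨
    K + K + length (enc S)                        ≡⟨ cong₂ _+_ (sym M≡K+K) (length-enc S) ⟩
    M + (length S * M + K)                        ≡⟨ +-assoc M _ K ⟨
    suc (length S) * M + K                        ∎
    where open ≡-Reasoning

  enc-infix : ∀ P V Q → enc (P ++ V ++ Q) ≡
              concatMap (λ a → B ++ code a) P ++ enc V ++ concatMap (λ a → code a ++ B) Q
  enc-infix P V Q = begin
    B ++ blocks (P ++ V ++ Q)              ≡⟨ cong (B ++_) (concatMap-++ _ P (V ++ Q)) ⟩
    B ++ blocks P ++ blocks (V ++ Q)       ≡⟨ ++-assoc B (blocks P) _ ⟨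
    (B ++ blocks P) ++ blocks (V ++ Q)     ≡⟨ cong (_++ blocks (V ++ Q)) (++-concatMap-rotate B code P) ⟩
    (blocks′ P ++ B) ++ blocks (V ++ Q)    ≡⟨ ++-assoc (blocks′ P) B _ ⟩
    blocks′ P ++ B ++ blocks (V ++ Q)      ≡⟨ cong (λ Z → blocks′ P ++ B ++ Z) (concatMap-++ _ V Q) ⟩
    blocks′ P ++ B ++ blocks V ++ blocks Q ≡⟨ cong (blocks′ P ++_) (++-assoc B (blocks V) (blocks Q)) ⟨
    blocks′ P ++ enc V ++ blocks Q         ∎
    where
    open ≡-Reasoning
    blocks blocks′ : List A → List Bool
    blocks  = concatMap (λ a → code a ++ B)
    blocks′ = concatMap (λ a → B ++ code a)

  enc-substring : ∀ S {V} → V ∈ substrings S → enc V ∈ substrings (enc S)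
  enc-substring S {V} V∈S with ∈substrings⇒infix S V∈S
  ... | P , Q , refl = subst (λ Z → enc V ∈ substrings Z) (sym (enc-infix P V Q))
    (infix∈substrings (concatMap (λ a → B ++ code a) P) (enc V) (concatMap (λ a → code a ++ B) Q))

  -- Block q of enc S occupies the positions q * M + s with s < M: the separator for
  -- s < K, then the code word of S !? q.
  !?-enc-∷ : ∀ a S n → enc (a ∷ S) !? (M + n) ≡ enc S !? n
  !?-enc-∷ a S n = begin
    enc (a ∷ S) !? (M + n)                                       ≡⟨ cong₂ _!?_ (enc-∷ a S) M+n≡ ⟩
    (B ++ code a ++ enc S) !? (length B + (length (code a) + n)) ≡⟨ !?-++ʳ B _ ⟩
    (code a ++ enc S) !? (length (code a) + n)                   ≡⟨ !?-++ʳ (code a) n ⟩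
    enc S !? n                                                   ∎
    where
    open ≡-Reasoning
    M+n≡ : M + n ≡ length B + (length (code a) + n)
    M+n≡ = trans (cong (_+ n) M≡K+K)
             (trans (+-assoc K K n) (sym (cong₂ (λ b c → b + (c + n)) length-B (length-code a))))

  !?-enc[]-≥K : ∀ {n} → K ≤ n → enc [] !? n ≡ nothing
  !?-enc[]-≥K K≤n = !?-≥length (enc []) (subst (_≤ _) (sym (length-enc [])) K≤n)

  !?-enc-separator : ∀ S q {s x} → enc S !? (q * M + s) ≡ just x → s < K → B !? s ≡ just x
  !?-enc-separator S       zero        e s<K = trans (sym (!?-++ˡ B (subst (_ <_) (sym length-B) s<K))) e
  !?-enc-separator []      (suc q) {s} e _   = contradiction (trans (sym e) (!?-enc[]-≥K K≤)) λ ()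
    where
    K≤ : K ≤ suc q * M + s
    K≤ = ≤-trans K≤M (≤-trans (m≤m+n M (q * M)) (m≤m+n _ s))
  !?-enc-separator (a ∷ S) (suc q) {s} e s<K =
    !?-enc-separator S q (trans (sym next-block) e) s<K
    where
    next-block : enc (a ∷ S) !? (suc q * M + s) ≡ enc S !? (q * M + s)
    next-block = trans (cong (enc (a ∷ S) !?_) (+-assoc M (q * M) s)) (!?-enc-∷ a S _)

  private
    next-block : ∀ q s → suc q * M + K + s ≡ M + (q * M + K + s)
    next-block q s = trans (cong (_+ s) (+-assoc M (q * M) K)) (+-assoc M (q * M + K) s)

  !?-enc-code : ∀ S q {a s} → S !? q ≡ just a → s < K → enc S !? (q * M + K + s) ≡ code a !? s
  !?-enc-code (a ∷ S) zero    {s = s} refl s<K = begin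
    enc (a ∷ S) !? (K + s)                   ≡⟨ cong₂ _!?_ (enc-∷ a S) (cong (_+ s) (sym length-B)) ⟩
    (B ++ code a ++ enc S) !? (length B + s) ≡⟨ !?-++ʳ B s ⟩
    (code a ++ enc S) !? s                   ≡⟨ !?-++ˡ (code a) (subst (s <_) (sym (length-code a)) s<K) ⟩
    code a !? s                              ∎
    where open ≡-Reasoning
  !?-enc-code (b ∷ S) (suc q) {s = s} S!?q s<K =
    trans (cong (enc (b ∷ S) !?_) (next-block q s)) (trans (!?-enc-∷ b S _) (!?-enc-code S q S!?q s<K))

  !?-enc-code-defined : ∀ S q {s x} → enc S !? (q * M + K + s) ≡ just x → ∃ λ a → S !? q ≡ just a
  !?-enc-code-defined []      q       {s} e =
    contradiction (trans (sym e) (!?-enc[]-≥K (≤-trans (m≤n+m K (q * M)) (m≤m+n _ s)))) λ ()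
  !?-enc-code-defined (a ∷ S) zero        e = a , refl
  !?-enc-code-defined (a ∷ S) (suc q) {s} e =
    !?-enc-code-defined S q (trans (sym (trans (cong (enc (a ∷ S) !?_) (next-block q s)) (!?-enc-∷ a S _))) e)

  module _ (code-sparse : ∀ a {n} → code a !? n ≡ just true → code a !? suc n ≡ just false)
           (code-injective : ∀ {a b} → code a ≡ code b → a ≡ b) where

    OnesRun : List A → ℕ → Set
    OnesRun S p = ∀ u → u < K ∸ 1 → enc S !? (p + u) ≡ just true

    ¬onesRun-in-separator : ∀ S q {s} → 0 < s → s < K → ¬ OnesRun S (q * M + s)
    ¬onesRun-in-separator S q {s} 0<s s<K run =
      contradiction (trans (sym (!?-enc-separator S q hits-last K∸1<K)) B-last) λ ()
      where
      s≤K∸1 : s ≤ K ∸ 1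
      s≤K∸1 = ≤-trans (<⇒≤pred s<K) (≤-reflexive (pred[m∸n]≡m∸[1+n] K 0))
      hits-last : enc S !? (q * M + (K ∸ 1)) ≡ just true
      hits-last = subst (λ n → enc S !? n ≡ just true)
                        (trans (+-assoc (q * M) s _) (cong (q * M +_) (m+[n∸m]≡n s≤K∸1)))
                        (run (K ∸ 1 ∸ s) (∸-monoʳ-< 0<s s≤K∸1))

    ¬onesRun-in-code : ∀ S q {r} → r < K → ¬ OnesRun S (q * M + K + r)
    ¬onesRun-in-code S q {r} r<K run = contradiction (trans (sym one-after) zero-after) λ ()
      where
      one-at : enc S !? (q * M + K + r) ≡ just true
      one-at = subst (λ n → enc S !? n ≡ just true) (+-identityʳ _) (run 0 (≤-trans (s≤s z≤n) 3≤K∸1))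
      one-after : enc S !? (q * M + K + r + 1) ≡ just true
      one-after = run 1 (≤-trans (s≤s (s≤s z≤n)) 3≤K∸1)
      a : A
      a = proj₁ (!?-enc-code-defined S q one-at)
      S!?q : S !? q ≡ just a
      S!?q = proj₂ (!?-enc-code-defined S q one-at)
      code-one : code a !? r ≡ just true
      code-one = trans (sym (!?-enc-code S q S!?q r<K)) one-at
      1+r<K : suc r < K
      1+r<K = subst (suc r <_) (length-code a) (!?-just⇒<length (code a) (code-sparse a code-one))
      zero-after : enc S !? (q * M + K + r + 1) ≡ just false
      zero-after = begin
        enc S !? (q * M + K + r + 1) ≡⟨ cong (enc S !?_) (trans (+-assoc (q * M + K) r 1)
                                                                  (cong (q * M + K +_) (+-comm r 1))) ⟩
        enc S !? (q * M + K + suc r) ≡⟨ !?-enc-code S q S!?q 1+r<K ⟩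
        code a !? suc r              ≡⟨ code-sparse a code-one ⟩
        just false                   ∎
        where open ≡-Reasoning

    onesRun⇒aligned : ∀ S p → OnesRun S p → M ∣ p
    onesRun⇒aligned S p run = m%n≡0⇒n∣m p M (offset≡0 (p % M) (m%n<n p M) (subst (OnesRun S) p≡ run))
      where
      q : ℕ
      q = p / M
      p≡ : p ≡ q * M + p % M
      p≡ = trans (m≡m%n+[m/n]*n p M) (+-comm (p % M) (q * M))
      offset≡0 : ∀ s → s < M → OnesRun S (q * M + s) → s ≡ 0
      offset≡0 zero    _   _   = refl
      offset≡0 (suc s) s<M run with suc s <? K
      ... | yes s<K = contradiction run (¬onesRun-in-separator S q z<s s<K)
      ... | no  s≮K with m≤n⇒∃[o]m+o≡n (≮⇒≥ s≮K)
      ...   | r , K+r≡ = contradiction (subst (OnesRun S) q*M+K+r≡ run) (¬onesRun-in-code S q r<K)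
        where
        r<K : r < K
        r<K = +-cancelˡ-< K r K (subst₂ _<_ (sym K+r≡) M≡K+K s<M)
        q*M+K+r≡ : q * M + suc s ≡ q * M + K + r
        q*M+K+r≡ = sym (trans (+-assoc (q * M) K r) (cong (q * M +_) K+r≡))

    code-start : ∀ t → t ≤ M → ∃ λ t′ → t′ ≤ M × (∀ x → M ∣ x + t → ∃ λ c → x + t′ ≡ c * M + K)
    code-start t t≤M with K ≤? t
    ... | yes K≤t = t ∸ K , ≤-trans (m∸n≤m t K) t≤M , back
      where
      back : ∀ x → M ∣ x + t → ∃ λ c → x + (t ∸ K) ≡ c * M + K
      back x (divides zero    x+t≡0) = contradiction (≤-trans K≤t (≤-trans (m≤n+m t x) (≤-reflexive x+t≡0)))
                                                     (<⇒≱ (≤-trans (s≤s z≤n) 4≤K))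
      back x (divides (suc c) x+t≡)  = c , +-cancelʳ-≡ K _ _ (begin
        x + (t ∸ K) + K ≡⟨ +-assoc x (t ∸ K) K ⟩
        x + (t ∸ K + K) ≡⟨ cong (x +_) (m∸n+n≡m K≤t) ⟩
        x + t           ≡⟨ x+t≡ ⟩
        M + c * M       ≡⟨ cong (_+ c * M) M≡K+K ⟩
        K + K + c * M   ≡⟨ +-comm (K + K) (c * M) ⟩
        c * M + (K + K) ≡⟨ +-assoc (c * M) K K ⟨
        c * M + K + K   ∎)
        where open ≡-Reasoning
    ... | no K≰t = t + K , subst (t + K ≤_) (sym M≡K+K) (+-monoˡ-≤ K (<⇒≤ (≰⇒> K≰t))) ,
                   λ x (divides c x+t≡) → c , trans (sym (+-assoc x t K)) (cong (_+ K) x+t≡)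

    match-separator⇒onesRun : ∀ S₁ S₂ {b j} → Match (enc S₁) (b * M) (enc S₂) j K → OnesRun S₂ j
    match-separator⇒onesRun S₁ S₂ {b} m u u<K∸1 =
      let x , S₁!? , S₂!? = agree m u u<K in
      trans S₂!? (trans (sym (!?-enc-separator S₁ b S₁!? u<K)) (B-ones u<K∸1))
      where
      u<K : u < K
      u<K = <-trans u<K∸1 K∸1<K

    match-code-aligned : ∀ S₁ S₂ {i j} n → Match (enc S₁) i (enc S₂) j (suc n * M + K) →
                         ∃₂ λ c d → Match (enc S₁) (c * M + K) (enc S₂) (d * M + K) (n * M + K)
    match-code-aligned S₁ S₂ {i} {j} n m =
      from-boundary (M ∸ i % M) (m∸n≤m M (i % M)) (m∣n+[m∸n%m] M i)
      where
      fits : ∀ {t} → t ≤ M → t + (n * M + K) ≤ suc n * M + K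
      fits {t} t≤M = ≤-trans (≤-reflexive (sym (+-assoc t (n * M) K))) (+-monoˡ-≤ K (+-monoˡ-≤ (n * M) t≤M))

      from-boundary : ∀ t → t ≤ M → M ∣ i + t →
                      ∃₂ λ c d → Match (enc S₁) (c * M + K) (enc S₂) (d * M + K) (n * M + K)
      from-boundary t t≤M (divides b i+t≡) with code-start t t≤M
      ... | t′ , t′≤M , to-code-start
          with to-code-start i (divides b i+t≡)
             | to-code-start j (onesRun⇒aligned S₂ (j + t) (match-separator⇒onesRun S₁ S₂ {b}
                 (subst (λ p → Match (enc S₁) p (enc S₂) (j + t) K) i+t≡
                   (match-drop t (match-≤ (≤-trans (+-monoʳ-≤ t (m≤n+m K (n * M))) (fits t≤M)) m)))))
      ... | c , i+t′≡ | d , j+t′≡ =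
        c , d , subst₂ (λ p p′ → Match (enc S₁) p (enc S₂) p′ (n * M + K)) i+t′≡ j+t′≡
                  (match-drop t′ (match-≤ (fits t′≤M) m))

    decode-block : ∀ S₁ S₂ c d → Match (enc S₁) (c * M + K) (enc S₂) (d * M + K) K →
                   ∃ λ a → S₁ !? c ≡ just a × S₂ !? d ≡ just a
    decode-block S₁ S₂ c d m with agree m 0 (≤-trans (s≤s z≤n) 4≤K)
    ... | _ , S₁!? , S₂!? with !?-enc-code-defined S₁ c S₁!? | !?-enc-code-defined S₂ d S₂!?
    ... | a , S₁!?c | b , S₂!?d = a , S₁!?c , subst (λ x → S₂ !? d ≡ just x) (sym a≡b) S₂!?d
      where
      a≡b : a ≡ b
      a≡b = code-injective (!?-ext-≤ (≤-reflexive (length-code a)) (≤-reflexive (length-code b)) λ s s<K →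
        let x , e₁ , e₂ = agree m s s<K in
        trans (sym (!?-enc-code S₁ c S₁!?c s<K))
              (trans e₁ (sym (trans (sym (!?-enc-code S₂ d S₂!?d s<K)) e₂))))

    decode-aligned : ∀ S₁ S₂ c d n → Match (enc S₁) (c * M + K) (enc S₂) (d * M + K) (n * M + K) →
                     Match S₁ c S₂ d (suc n)
    decode-aligned S₁ S₂ c d n m = matching λ t t≤n →
      decode-block S₁ S₂ (c + t) (d + t)
        (subst₂ (λ p p′ → Match (enc S₁) p (enc S₂) p′ K) (block c t) (block d t)
          (match-drop (t * M) (match-≤ (+-monoˡ-≤ K (*-monoˡ-≤ M (s≤s⁻¹ t≤n))) m)))
      where
      block : ∀ c t → c * M + K + t * M ≡ (c + t) * M + K
      block c t = begin
        c * M + K + t * M   ≡⟨ +-assoc (c * M) K (t * M) ⟩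
        c * M + (K + t * M) ≡⟨ cong (c * M +_) (+-comm K (t * M)) ⟩
        c * M + (t * M + K) ≡⟨ +-assoc (c * M) (t * M) K ⟨
        c * M + t * M + K   ≡⟨ cong (_+ K) (*-distribʳ-+ M c t) ⟨
        (c + t) * M + K     ∎
        where open ≡-Reasoning

    decode-match : ∀ S₁ S₂ {i j} n → Match (enc S₁) i (enc S₂) j (n * M + K) → ∃₂ λ c d → Match S₁ c S₂ d n
    decode-match S₁ S₂ zero    _ = 0 , 0 , matching λ _ ()
    decode-match S₁ S₂ (suc n) m with match-code-aligned S₁ S₂ n m
    ... | c , d , m′ = c , d , decode-aligned S₁ S₂ c d n m′

    LCF-encodeWith : ∀ (_≟_ : DecidableEquality A) S₁ S₂ →
      LCF _≟_ S₁ S₂ ≡ (LCF Data.Bool.Properties._≟_ (enc S₁) (enc S₂) ∸ 2 * k) / (4 * k)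
    LCF-encodeWith _≟_ S₁ S₂ =
      sym (m*n≤o<[1+m]*n⇒o/n≡m (m+n≤o⇒m≤o∸n (l * M) lower)
                               (m<n+o⇒m∸n<o L K {{m*n≢0 (suc l) M}} upper))
      where
      l L : ℕ
      l = LCF _≟_ S₁ S₂
      L = LCF Data.Bool.Properties._≟_ (enc S₁) (enc S₂)

      lower : l * M + K ≤ L
      lower =
        let V , V∈S₁ , V∈S₂ , |V|≡l = LCF-attained _≟_ S₁ S₂ in
        subst (_≤ L) (trans (length-enc V) (cong (λ n → n * M + K) |V|≡l))
          (LCF-≥ Data.Bool.Properties._≟_ (enc S₁) (enc S₂)
                 (enc-substring S₁ V∈S₁) (enc-substring S₂ V∈S₂))

      too-long : suc l * M + K ≤ L → ⊥
      too-long long =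
        let U , U∈S₁ , U∈S₂ , |U|≡L = LCF-attained Data.Bool.Properties._≟_ (enc S₁) (enc S₂)
            _ , _ , m = common⇒match (enc S₁) (enc S₂) U∈S₁ U∈S₂
            _ , _ , m′ = decode-match S₁ S₂ (suc l) (match-≤ (≤-trans long (≤-reflexive (sym |U|≡L))) m)
        in 1+n≰n (match⇒≤LCF _≟_ m′)

      upper : L < K + suc l * M
      upper = subst (L <_) (+-comm _ K) (≰⇒> too-long)

length-pad : ∀ xs → length (pad xs) ≡ 2 * length xs
length-pad []       = refl
length-pad (x ∷ xs) = trans (cong (2 +_) (length-pad xs)) (sym (*-suc 2 (length xs)))

pad-injective : ∀ {xs ys} → pad xs ≡ pad ys → xs ≡ ys
pad-injective {[]}     {[]}     _ = refl
pad-injective {x ∷ xs} {y ∷ ys} e = cong₂ _∷_ (∷-injectiveˡ e) (pad-injective (∷-injectiveʳ (∷-injectiveʳ e)))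

pad-sparse : ∀ xs {n} → pad xs !? n ≡ just true → pad xs !? suc n ≡ just false
pad-sparse (x ∷ xs) {zero}        _ = refl
pad-sparse (x ∷ xs) {suc (suc n)} e = pad-sparse xs e

length-bin : ∀ k x → length (bin k x) ≡ k
length-bin zero    x = refl
length-bin (suc k) x = trans (length-++ (bin k (x / 2))) (trans (+-comm _ 1) (cong suc (length-bin k (x / 2))))

bit-injective : ∀ {m n} → m < 2 → n < 2 → does (m Data.Nat.≟ 1) ≡ does (n Data.Nat.≟ 1) → m ≡ n
bit-injective {0}           {0}           _                _                _  = refl
bit-injective {1}           {1}           _                _                _  = refl
bit-injective {0}           {1}           _                _                ()
bit-injective {1}           {0}           _                _                ()
bit-injective {suc (suc _)} {_}           (s≤s (s≤s ()))   _                _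
bit-injective {_}           {suc (suc _)} _                (s≤s (s≤s ()))   _

bin-injective : ∀ k {x y} → x < 2 ^ k → y < 2 ^ k → bin k x ≡ bin k y → x ≡ y
bin-injective zero    {zero}  {zero}  _        _        _ = refl
bin-injective zero    {suc _} {_}     (s≤s ()) _        _
bin-injective zero    {_}     {suc _} _        (s≤s ()) _
bin-injective (suc k) {x}     {y}     x<       y<       e with ∷ʳ-injective (bin k (x / 2)) (bin k (y / 2)) e
... | high≡ , low≡ = begin
  x                 ≡⟨ m≡m%n+[m/n]*n x 2 ⟩
  x % 2 + x / 2 * 2 ≡⟨ cong₂ (λ r q → r + q * 2) (bit-injective (m%n<n x 2) (m%n<n y 2) low≡)
                                                 (bin-injective k (half< x<) (half< y<) high≡) ⟩
  y % 2 + y / 2 * 2 ≡⟨ m≡m%n+[m/n]*n y 2 ⟨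
  y                 ∎
  where
  open ≡-Reasoning
  half< : ∀ {z} → z < 2 ^ suc k → z / 2 < 2 ^ k
  half< {z} z< = m<n*o⇒m/o<n (subst (z <_) (*-comm 2 (2 ^ k)) z<)

n≤2^⌈log2⌉n : ∀ n (rec : Acc _<_ n) → n ≤ 2 ^ ⌈log2⌉ n rec
n≤2^⌈log2⌉n zero          _        = z≤n
n≤2^⌈log2⌉n (suc zero)    _        = ≤-refl
n≤2^⌈log2⌉n (suc (suc n)) (acc rs) = begin
  2 + n                     ≤⟨ +-monoʳ-≤ 2 n≤2⌈n/2⌉ ⟩
  2 + (⌈ n /2⌉ + ⌈ n /2⌉)   ≡⟨ cong suc (+-suc ⌈ n /2⌉ ⌈ n /2⌉) ⟨
  suc ⌈ n /2⌉ + suc ⌈ n /2⌉ ≤⟨ +-mono-≤ ih ih ⟩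
  2 ^ e + 2 ^ e             ≡⟨ cong (2 ^ e +_) (+-identityʳ (2 ^ e)) ⟨
  2 ^ suc e                 ∎
  where
  open ≤-Reasoning
  e : ℕ
  e = ⌈log2⌉ (suc ⌈ n /2⌉) _
  ih : suc ⌈ n /2⌉ ≤ 2 ^ e
  ih = n≤2^⌈log2⌉n (suc ⌈ n /2⌉) _
  n≤2⌈n/2⌉ : n ≤ ⌈ n /2⌉ + ⌈ n /2⌉
  n≤2⌈n/2⌉ = subst (_≤ ⌈ n /2⌉ + ⌈ n /2⌉) (⌊n/2⌋+⌈n/2⌉≡n n) (+-monoˡ-≤ ⌈ n /2⌉ (⌊n/2⌋≤⌈n/2⌉ n))

n≤2^⌈log₂n⌉ : ∀ n → n ≤ 2 ^ ⌈log₂ n ⌉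
n≤2^⌈log₂n⌉ n = n≤2^⌈log2⌉n n _

module _ (k : ℕ) {σ : ℕ} where

  length-C : ∀ (a : Fin σ) → length (C k a) ≡ 2 * k
  length-C a = trans (length-pad (bin k (toℕ a))) (cong (2 *_) (length-bin k (toℕ a)))

  C-sparse : ∀ (a : Fin σ) {n} → C k a !? n ≡ just true → C k a !? suc n ≡ just false
  C-sparse a = pad-sparse (bin k (toℕ a))

  C-injective : σ ≤ 2 ^ k → ∀ {a b : Fin σ} → C k a ≡ C k b → a ≡ b
  C-injective σ≤2^k {a} {b} e =
    toℕ-injective (bin-injective k (<-≤-trans (toℕ<n a) σ≤2^k) (<-≤-trans (toℕ<n b) σ≤2^k) (pad-injective e))

mainTheorem14 : (σ : ℕ) (h : 3 ≤ σ) (S₁ S₂ : List (Fin σ)) → 0 < length S₁ → 0 < length S₂ →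
    LCF Data.Fin.Properties._≟_ S₁ S₂
      ≡ _/_ (LCF Data.Bool.Properties._≟_ (encode ⌈log₂ σ ⌉ S₁) (encode ⌈log₂ σ ⌉ S₂) ∸ 2 * ⌈log₂ σ ⌉)
            (4 * ⌈log₂ σ ⌉) {{nz4k σ h}}
mainTheorem14 σ h S₁ S₂ _ _ =
  LCF-encodeWith (C-sparse k) (C-injective k (n≤2^⌈log₂n⌉ σ)) Data.Fin.Properties._≟_ S₁ S₂
  where
  k : ℕ
  k = ⌈log₂ σ ⌉
  open BlockEncoding k (⌈log₂⌉-mono-≤ h) (C k) (length-C k)
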